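{- Let $\beta\ge2$ be an integer and $k\ge0$. The sequence $(\Phi_{\beta^k}(n))_{n\in\mathbb{N}}$ is periodic. Furthermore, if $\beta$ is not divisible by any Wall–Sun–Sun prime, then the length $N_k$ of its shortest period equals $\pi(\beta^{k+1})$.
   Context: The Fibonacci numbers are $F_0=0$, $F_1=1$, $F_n=F_{n-1}+F_{n-2}$. For a base $\beta$ and $k\ge0$, $\Phi_{\beta^k}(n)=\lfloor F_n/\beta^k\rfloor \bmod \beta$ is the digit in the $\beta^k$'s place of $F_n$ written in base $\beta$. For a positive integer $m$, the Pisano period $\pi(m)$ is the smallest $k>0$ with $F_k\equiv0$ and $F_{k+1}\equiv1 \pmod m$. A Wall–Sun–Sun prime is a prime $p$ with $\pi(p)=\pi(p^2)$. -}

module Defs where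

open import Data.Nat using (ℕ; zero; suc; _+_; _*_; _^_; _<_; _≥_; NonZero)
open import Data.Nat.DivMod using (_/_; _%_)
open import Data.Nat.Primality using (Prime)
open import Data.Product using (_×_; ∃-syntax)
open import Relation.Binary.PropositionalEquality using (_≡_)

fib : ℕ → ℕ
fib zero = zero
fib (suc zero) = suc zero
fib (suc (suc n)) = fib (suc n) + fib n

Φ : (β k : ℕ) → .{{_ : NonZero β}} → ℕ → ℕ
Φ β k n = ((fib n / (β ^ k)) {{Data.Nat.Properties.m^n≢0 β k}}) % β
  where import Data.Nat.Properties

IsPeriod : (ℕ → ℕ) → ℕ → Set
IsPeriod s N = 0 < N × (∀ n → s (n + N) ≡ s n)

Periodic : (ℕ → ℕ) → Set
Periodic s = ∃[ N ] IsPeriod s N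

IsShortestPeriod : (ℕ → ℕ) → ℕ → Set
IsShortestPeriod s N = IsPeriod s N × (∀ M → IsPeriod s M → N Data.Nat.≤ M)
  where import Data.Nat

PisanoCond : (m : ℕ) → .{{_ : NonZero m}} → ℕ → Set
PisanoCond m k = 0 < k × (fib k % m ≡ 0 % m) × (fib (suc k) % m ≡ 1 % m)

IsPisanoPeriod : (m : ℕ) → .{{_ : NonZero m}} → ℕ → Set
IsPisanoPeriod m k = PisanoCond m k × (∀ j → PisanoCond m j → k Data.Nat.≤ j)
  where import Data.Nat

WallSunSun : ℕ → Set
WallSunSun zero = Data.Empty.⊥
  where import Data.Empty
WallSunSun (suc q) =
  Prime (suc q) × ∃[ k ] (IsPisanoPeriod (suc q) k × IsPisanoPeriod (suc q * suc q) k)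

-- Write F n = low n + β^k · high n, so that Φ β k n = high n mod β. A period of F modulo
-- β^(k+1) is clearly a period of Φ β k. Conversely, if M is a period of the digits, the carries
-- c n ∈ {0, 1} in low (n+2) + c n · β^k = low (n+1) + low n are M-periodic, being determined
-- modulo β ≥ 2 by three consecutive digits. Hence n ↦ low (n + M) − low n is an integer solution
-- of the Fibonacci recurrence bounded by β^k, and such a solution vanishes: while its signs
-- alternate, |v n| + |v (n+1)| decreases, and two consecutive terms of equal sign make it grow
-- without bound. So the periods of Φ β k are exactly the n > 0 with F n ≡ 0 and F (n+1) ≡ 1
-- modulo β^(k+1), and such n exist by pigeonhole on pairs of consecutive residues.

module Submission where

open import Defs
open import Data.Nat using (ℕ; _+_; _^_; _≤_; NonZero)
open import Data.Nat.Divisibility using (_∣_)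
open import Data.Nat.Properties using (m^n≢0)
open import Data.Product using (_×_)
open import Relation.Nullary using (¬_)
open import Function.Bundles using (_⇔_)

open import Data.Nat using (zero; suc; _*_; _∸_; _<_; z<s)
open import Data.Nat.Properties
  using (+-comm; +-identityʳ; ≤-trans; ≤-<-trans; <-≤-trans; <-asym; m≤m+n; m<m+n; +-mono-<; +-monoʳ-<;
         m<n⇒0<n∸m; m+[n∸m]≡n; n<1+n; <⇒≤; ⊔-pres-<m; m*n≢0)
open import Data.Nat.DivMod
open import Data.Nat.Divisibility using (divides)
open import Data.Nat.Induction using (<-wellFounded)
open import Induction.WellFounded using (Acc; acc)
open import Data.Integer as ℤ using (ℤ; +_; +0; +[1+_]; -[1+_]; -_; ∣_∣; -<+)
open import Data.Integer.Properties
  using (neg-injective; neg-distrib-+; ∣-i∣≡∣i∣; +-identityˡ; +-monoˡ-<;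
         drop‿+<+; +-injective; [+m]-[+n]≡m⊖n; ∣m⊝n∣≤m⊔n; i-j≡0⇒i≡j; module ≤-Reasoning)
import Data.Nat.Tactic.RingSolver as ℕ-Solver
import Data.Integer.Tactic.RingSolver as ℤ-Solver
open import Data.Fin using (Fin; toℕ; combine)
open import Data.Fin.Properties using (pigeonhole; combine-injectiveˡ; combine-injectiveʳ; toℕ-fromℕ<)
open import Data.Product using (_,_; proj₁; map; ∃-syntax)
open import Data.Empty using (⊥; ⊥-elim)
open import Function.Base using (_∘_; id)
open import Function.Construct.Composition using (_⇔-∘_)
open import Function.Construct.Identity using (⇔-id)
open import Data.Product.Function.NonDependent.Propositional using (_×-⇔_)
open import Function.Bundles using (mk⇔; Equivalence)
open import Relation.Binary.PropositionalEquality

variable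
  a b B M : ℕ
  v : ℕ → ℤ

-- Bounded integer solutions of the Fibonacci recurrence

FibonacciLike : (ℕ → ℤ) → Set
FibonacciLike v = ∀ n → v (2 + n) ≡ v (1 + n) ℤ.+ v n

BoundedBy : ℕ → (ℕ → ℤ) → Set
BoundedBy B v = ∀ n → ∣ v n ∣ < B

fibFrom : ℕ → ℕ → ℕ → ℕ
fibFrom a b zero = a
fibFrom a b (suc zero) = b
fibFrom a b (suc (suc n)) = fibFrom a b (suc n) + fibFrom a b n

fibFrom-pos : ∀ a b → 0 < a + b → ∀ n → 0 < fibFrom a b (2 + n)
fibFrom-pos a b 0<a+b zero    = subst (0 <_) (+-comm a b) 0<a+b
fibFrom-pos a b 0<a+b (suc n) = ≤-trans (fibFrom-pos a b 0<a+b n) (m≤m+n _ (fibFrom a b (suc n)))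

fibFrom-unbounded : ∀ a b → 0 < a + b → ∀ n → n < fibFrom a b (3 + n)
fibFrom-unbounded a b 0<a+b zero    = fibFrom-pos a b 0<a+b 1
fibFrom-unbounded a b 0<a+b (suc n) =
  ≤-<-trans (fibFrom-unbounded a b 0<a+b n) (m<m+n _ (fibFrom-pos a b 0<a+b n))

fibonacciLike-from : ∀ v → FibonacciLike v → v 0 ≡ + a → v 1 ≡ + b → ∀ n → v n ≡ + fibFrom a b n
fibonacciLike-from {a} {b} v rec v₀ v₁ n = proj₁ (pair n)
  where
  pair : ∀ n → v n ≡ + fibFrom a b n × v (suc n) ≡ + fibFrom a b (suc n)
  pair zero    = v₀ , v₁
  pair (suc n) with pair n
  ... | vₙ , vₙ₊₁ = vₙ₊₁ , trans (rec n) (cong₂ ℤ._+_ vₙ₊₁ vₙ)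

fibonacciLike-nonneg-unbounded :
  ∀ v → FibonacciLike v → BoundedBy B v → v 0 ≡ + a → v 1 ≡ + b → 0 < a + b → ⊥
fibonacciLike-nonneg-unbounded {B} {a} {b} v rec bnd v₀ v₁ 0<a+b =
  <-asym (subst (λ z → ∣ z ∣ < B) (fibonacciLike-from v rec v₀ v₁ (3 + B)) (bnd (3 + B)))
         (fibFrom-unbounded a b 0<a+b B)

nonneg-bounded-zero :
  ∀ v → FibonacciLike v → BoundedBy B v → v 0 ≡ + a → v 1 ≡ + b → v 0 ≡ +0 × v 1 ≡ +0
nonneg-bounded-zero {a = zero}  {b = zero}  _ _   _   v₀ v₁ = v₀ , v₁
nonneg-bounded-zero {a = zero}  {b = suc _} v rec bnd v₀ v₁ =
  ⊥-elim (fibonacciLike-nonneg-unbounded v rec bnd v₀ v₁ z<s)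
nonneg-bounded-zero {a = suc _}             v rec bnd v₀ v₁ =
  ⊥-elim (fibonacciLike-nonneg-unbounded v rec bnd v₀ v₁ z<s)

negate-fibonacciLike : ∀ v → FibonacciLike v → FibonacciLike (λ n → - v n)
negate-fibonacciLike v rec n = trans (cong -_ (rec n)) (neg-distrib-+ (v (suc n)) (v n))

negate-boundedBy : ∀ v → BoundedBy B v → BoundedBy B (λ n → - v n)
negate-boundedBy {B} v bnd n = subst (_< B) (sym (∣-i∣≡∣i∣ (v n))) (bnd n)

nonpos-bounded-zero :
  ∀ v → FibonacciLike v → BoundedBy B v → - v 0 ≡ + a → - v 1 ≡ + b → v 0 ≡ +0 × v 1 ≡ +0
nonpos-bounded-zero v rec bnd v₀ v₁ =
  map neg-injective neg-injective
    (nonneg-bounded-zero (λ n → - v n) (negate-fibonacciLike v rec) (negate-boundedBy v bnd) v₀ v₁)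

zero-from-shift : ∀ v → FibonacciLike v → v 1 ≡ +0 × v 2 ≡ +0 → v 0 ≡ +0 × v 1 ≡ +0
zero-from-shift v rec (v₁ , v₂) = v₀ , v₁
  where
  open ≡-Reasoning
  v₀ : v 0 ≡ +0
  v₀ = begin
    v 0            ≡⟨ +-identityˡ (v 0) ⟨
    +0 ℤ.+ v 0     ≡⟨ cong (ℤ._+ v 0) v₁ ⟨
    v 1 ℤ.+ v 0    ≡⟨ rec 0 ⟨
    v 2            ≡⟨ v₂ ⟩
    +0             ∎

mutual
  bounded-zero-pair : ∀ v x y → FibonacciLike v → BoundedBy B v → v 0 ≡ x → v 1 ≡ y →
                      Acc _<_ (∣ x ∣ + ∣ y ∣) → v 0 ≡ +0 × v 1 ≡ +0
  bounded-zero-pair v (+ _)    (+ _)    rec bnd v₀ v₁ _ = nonneg-bounded-zero v rec bnd v₀ v₁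
  bounded-zero-pair v +0       -[1+ _ ] rec bnd v₀ v₁ _ =
    nonpos-bounded-zero v rec bnd (cong -_ v₀) (cong -_ v₁)
  bounded-zero-pair v -[1+ _ ] +0       rec bnd v₀ v₁ _ =
    nonpos-bounded-zero v rec bnd (cong -_ v₀) (cong -_ v₁)
  bounded-zero-pair v -[1+ _ ] -[1+ _ ] rec bnd v₀ v₁ _ =
    nonpos-bounded-zero v rec bnd (cong -_ v₀) (cong -_ v₁)
  bounded-zero-pair v +[1+ _ ] -[1+ _ ] rec bnd v₀ v₁ ac =
    alternating-bounded-zero v rec bnd v₀ v₁ (v 2) refl ac
  bounded-zero-pair v -[1+ _ ] +[1+ _ ] rec bnd v₀ v₁ ac =
    map neg-injective neg-injective
      (alternating-bounded-zero (λ n → - v n) (negate-fibonacciLike v rec) (negate-boundedBy v bnd)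
        (cong -_ v₀) (cong -_ v₁) (- v 2) refl ac)

  alternating-bounded-zero :
    ∀ v → FibonacciLike v → BoundedBy B v → v 0 ≡ +[1+ a ] → v 1 ≡ -[1+ b ] →
    ∀ z → v 2 ≡ z → Acc _<_ (suc a + suc b) → v 0 ≡ +0 × v 1 ≡ +0
  alternating-bounded-zero v rec bnd v₀ v₁ +0 v₂ _ =
    zero-from-shift v rec
      (nonpos-bounded-zero (v ∘ suc) (rec ∘ suc) (bnd ∘ suc) (cong -_ v₁) (cong -_ v₂))
  alternating-bounded-zero v rec bnd v₀ v₁ -[1+ _ ] v₂ _ =
    zero-from-shift v rec
      (nonpos-bounded-zero (v ∘ suc) (rec ∘ suc) (bnd ∘ suc) (cong -_ v₁) (cong -_ v₂))
  alternating-bounded-zero {a = a} {b = b} v rec bnd v₀ v₁ +[1+ t ] v₂ (acc rs) =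
    zero-from-shift v rec
      (bounded-zero-pair (v ∘ suc) -[1+ b ] +[1+ t ] (rec ∘ suc) (bnd ∘ suc) v₁ v₂
        (rs (subst (suc b + suc t <_) (+-comm (suc b) (suc a)) (+-monoʳ-< (suc b) t<a))))
    where
    open ≤-Reasoning
    t<a : suc t < suc a
    t<a = drop‿+<+ (begin-strict
      +[1+ t ]       ≡⟨ v₂ ⟨
      v 2            ≡⟨ rec 0 ⟩
      v 1 ℤ.+ v 0    <⟨ +-monoˡ-< (v 0) (subst (ℤ._< +0) (sym v₁) -<+) ⟩
      +0 ℤ.+ v 0     ≡⟨ +-identityˡ (v 0) ⟩
      v 0            ≡⟨ v₀ ⟩
      +[1+ a ]       ∎)

bounded-fibonacciLike-zero : ∀ v → FibonacciLike v → BoundedBy B v → ∀ n → v n ≡ +0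
bounded-fibonacciLike-zero v rec bnd n =
  proj₁ (bounded-zero-pair (λ i → v (i + n)) _ _ (λ i → rec (i + n)) (λ i → bnd (i + n)) refl refl
           (<-wellFounded _))

difference-fibonacciLike : ∀ {x₂ x₁ x₀ y₂ y₁ y₀} e → x₂ + e ≡ x₁ + x₀ → y₂ + e ≡ y₁ + y₀ →
                           + x₂ ℤ.- + y₂ ≡ (+ x₁ ℤ.- + y₁) ℤ.+ (+ x₀ ℤ.- + y₀)
difference-fibonacciLike {x₂} {x₁} {x₀} {y₂} {y₁} {y₀} e xs ys = begin
  + x₂ ℤ.- + y₂                                 ≡⟨ cancel (+ x₂) (+ y₂) (+ e) ⟩
  (+ x₂ ℤ.+ + e) ℤ.- (+ y₂ ℤ.+ + e)             ≡⟨ cong₂ ℤ._-_ (cong +_ xs) (cong +_ ys) ⟩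
  (+ x₁ ℤ.+ + x₀) ℤ.- (+ y₁ ℤ.+ + y₀)           ≡⟨ regroup (+ x₁) (+ x₀) (+ y₁) (+ y₀) ⟩
  (+ x₁ ℤ.- + y₁) ℤ.+ (+ x₀ ℤ.- + y₀)           ∎
  where
  open ≡-Reasoning
  cancel : ∀ p q r → p ℤ.- q ≡ (p ℤ.+ r) ℤ.- (q ℤ.+ r)
  cancel = ℤ-Solver.solve-∀
  regroup : ∀ p q r s → (p ℤ.+ q) ℤ.- (r ℤ.+ s) ≡ (p ℤ.- r) ℤ.+ (q ℤ.- s)
  regroup = ℤ-Solver.solve-∀

∣[+x]-[+y]∣< : ∀ {x y} → x < B → y < B → ∣ + x ℤ.- + y ∣ < B
∣[+x]-[+y]∣< {x = x} {y} x<B y<B =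
  subst (_< _) (sym (cong ∣_∣ ([+m]-[+n]≡m⊖n x y))) (≤-<-trans (∣m⊝n∣≤m⊔n x y) (⊔-pres-<m x<B y<B))

infix 4 _≡_[mod_]
_≡_[mod_] : ℕ → ℕ → (m : ℕ) → .{{NonZero m}} → Set
x ≡ y [mod m ] = x % m ≡ y % m

+-cong-mod : ∀ {m} .{{_ : NonZero m}} {x x′ y y′} →
             x ≡ x′ [mod m ] → y ≡ y′ [mod m ] → x + y ≡ x′ + y′ [mod m ]
+-cong-mod {m} {x} {x′} {y} {y′} x≡x′ y≡y′ = begin
  (x + y) % m               ≡⟨ %-distribˡ-+ x y m ⟩
  (x % m + y % m) % m       ≡⟨ cong₂ (λ p q → (p + q) % m) x≡x′ y≡y′ ⟩
  (x′ % m + y′ % m) % m     ≡⟨ %-distribˡ-+ x′ y′ m ⟨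
  (x′ + y′) % m             ∎
  where open ≡-Reasoning

-- Adding a * (m - 1) undoes adding a, up to the multiple a * m.
+-cancelˡ-mod : ∀ {m} .{{_ : NonZero m}} a {x y} → a + x ≡ a + y [mod m ] → x ≡ y [mod m ]
+-cancelˡ-mod {m@(suc p)} a {x} {y} eq = begin
  x % m                     ≡⟨ [m+kn]%n≡m%n x a m ⟨
  (x + a * m) % m           ≡⟨ cong (_% m) (complement x a p) ⟩
  (a * p + (a + x)) % m     ≡⟨ +-cong-mod {x = a * p} {a * p} {a + x} {a + y} refl eq ⟩
  (a * p + (a + y)) % m     ≡⟨ cong (_% m) (complement y a p) ⟨
  (y + a * m) % m           ≡⟨ [m+kn]%n≡m%n y a m ⟩
  y % m                     ∎
  where
  open ≡-Reasoning
  complement : ∀ z a p → z + a * suc p ≡ a * p + (a + z)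
  complement = ℕ-Solver.solve-∀

module _ {B} .{{_ : NonZero B}} where

  +-%-/-split : ∀ x y → x + y ≡ (x % B + y % B) + (x / B + y / B) * B
  +-%-/-split x y = begin
    x + y                                       ≡⟨ cong₂ _+_ (m≡m%n+[m/n]*n x B) (m≡m%n+[m/n]*n y B) ⟩
    (x % B + x / B * B) + (y % B + y / B * B)   ≡⟨ ring (x % B) (x / B) (y % B) (y / B) B ⟩
    (x % B + y % B) + (x / B + y / B) * B       ∎
    where
    open ≡-Reasoning
    ring : ∀ r q r′ q′ b → (r + q * b) + (r′ + q′ * b) ≡ (r + r′) + (q + q′) * b
    ring = ℕ-Solver.solve-∀

  /-+-carry : ∀ x y → (x + y) / B ≡ x / B + y / B + (x % B + y % B) / B
  /-+-carry x y = begin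
    (x + y) / B                                        ≡⟨ /-congˡ (+-%-/-split x y) ⟩
    ((x % B + y % B) + (x / B + y / B) * B) / B        ≡⟨ +-distrib-/-∣ʳ (x % B + y % B) (divides (x / B + y / B) refl) ⟩
    (x % B + y % B) / B + (x / B + y / B) * B / B      ≡⟨ cong (λ q → (x % B + y % B) / B + q) (m*n/n≡m _ B) ⟩
    (x % B + y % B) / B + (x / B + y / B)              ≡⟨ +-comm _ (x / B + y / B) ⟩
    x / B + y / B + (x % B + y % B) / B                ∎
    where open ≡-Reasoning

  %-+-carry : ∀ x y → (x + y) % B + (x % B + y % B) / B * B ≡ x % B + y % B
  %-+-carry x y = begin
    (x + y) % B + (x % B + y % B) / B * B              ≡⟨ cong (_+ (x % B + y % B) / B * B) (%-distribˡ-+ x y B) ⟩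
    (x % B + y % B) % B + (x % B + y % B) / B * B      ≡⟨ m≡m%n+[m/n]*n (x % B + y % B) B ⟨
    x % B + y % B                                      ∎
    where open ≡-Reasoning

  carry<2 : ∀ x y → (x % B + y % B) / B < 2
  carry<2 x y = m<n*o⇒m/o<n (subst (x % B + y % B <_) (cong (λ k → B + k) (sym (+-identityʳ B)))
                                   (+-mono-< (m%n<n x B) (m%n<n y B)))

m%[n*o]≡m%o+[m/o%n]*o : ∀ x n o .{{_ : NonZero n}} .{{_ : NonZero o}} {{_ : NonZero (n * o)}} →
                        x % (n * o) ≡ x % o + x / o % n * o
m%[n*o]≡m%o+[m/o%n]*o x n o = begin
  x % (n * o)                                ≡⟨ m≡m%n+[m/n]*n (x % (n * o)) o ⟩
  x % (n * o) % o + x % (n * o) / o * o      ≡⟨ cong₂ (λ r q → r + q * o) (m∣n⇒o%n%m≡o%m o (n * o) x (divides n refl))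
                                                                         (m%[n*o]/o≡m/o%n x n o) ⟩
  x % o + x / o % n * o                      ∎
  where open ≡-Reasoning

-- Fibonacci-like sequences modulo m and their base-β digits

module FibonacciLikeSequence (f : ℕ → ℕ) (f-rec : ∀ n → f (2 + n) ≡ f (1 + n) + f n) where

  ShiftCongruentAt : (m : ℕ) .{{_ : NonZero m}} → ℕ → ℕ → Set
  ShiftCongruentAt m d a = f (a + d) ≡ f a [mod m ] × f (suc a + d) ≡ f (suc a) [mod m ]

  module _ {m} .{{_ : NonZero m}} {d : ℕ} where

    shiftCongruentAt-suc : ∀ {a} → ShiftCongruentAt m d a → ShiftCongruentAt m d (suc a)
    shiftCongruentAt-suc {a} (p₀ , p₁) = p₁ , (begin
      f (2 + (a + d)) % m                 ≡⟨ %-congˡ (f-rec (a + d)) ⟩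
      (f (1 + (a + d)) + f (a + d)) % m   ≡⟨ +-cong-mod {x = f (1 + (a + d))} {f (1 + a)} {f (a + d)} {f a}
                                                        p₁ p₀ ⟩
      (f (1 + a) + f a) % m               ≡⟨ %-congˡ (f-rec a) ⟨
      f (2 + a) % m                       ∎)
      where open ≡-Reasoning

    shiftCongruentAt-pred : ∀ {a} → ShiftCongruentAt m d (suc a) → ShiftCongruentAt m d a
    shiftCongruentAt-pred {a} (p₁ , p₂) = +-cancelˡ-mod (f (1 + a)) (begin
      (f (1 + a) + f (a + d)) % m         ≡⟨ +-cong-mod {x = f (1 + a)} {f (1 + (a + d))} {f (a + d)} {f (a + d)}
                                                        (sym p₁) refl ⟩
      (f (1 + (a + d)) + f (a + d)) % m   ≡⟨ %-congˡ (f-rec (a + d)) ⟨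
      f (2 + (a + d)) % m                 ≡⟨ p₂ ⟩
      f (2 + a) % m                       ≡⟨ %-congˡ (f-rec a) ⟩
      (f (1 + a) + f a) % m               ∎) , p₁
      where open ≡-Reasoning

    shiftCongruentAt-zero : ∀ a → ShiftCongruentAt m d a → ShiftCongruentAt m d 0
    shiftCongruentAt-zero zero    p = p
    shiftCongruentAt-zero (suc a) p = shiftCongruentAt-zero a (shiftCongruentAt-pred p)

    shiftCongruent-everywhere : ShiftCongruentAt m d 0 → ∀ n → f (n + d) ≡ f n [mod m ]
    shiftCongruent-everywhere p n = proj₁ (at n)
      where
      at : ∀ n → ShiftCongruentAt m d n
      at zero    = p
      at (suc n) = shiftCongruentAt-suc (at n)

  module _ {m} .{{_ : NonZero m}} where

    mod-≡⇒≡[mod] : ∀ x y → x mod m ≡ y mod m → x ≡ y [mod m ]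
    mod-≡⇒≡[mod] x y eq = trans (sym (toℕ-fromℕ< _)) (trans (cong toℕ eq) (toℕ-fromℕ< _))

    residuePair : ℕ → Fin (m * m)
    residuePair i = combine (f i mod m) (f (suc i) mod m)

    residuePair-≡ : ∀ {i j} → residuePair i ≡ residuePair j →
                    f i ≡ f j [mod m ] × f (suc i) ≡ f (suc j) [mod m ]
    residuePair-≡ {i} {j} eq =
      mod-≡⇒≡[mod] (f i) (f j) (combine-injectiveˡ (f i mod m) _ (f j mod m) _ eq) ,
      mod-≡⇒≡[mod] (f (suc i)) (f (suc j)) (combine-injectiveʳ (f i mod m) _ (f j mod m) _ eq)

    shiftCongruentAt-between : ∀ {i j} → i ≤ j → residuePair i ≡ residuePair j → ShiftCongruentAt m (j ∸ i) i
    shiftCongruentAt-between {i} {j} i≤j eq rewrite m+[n∸m]≡n i≤j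
      with p₀ , p₁ ← residuePair-≡ eq = sym p₀ , sym p₁

    shiftCongruent-exists : ∃[ d ] 0 < d × ShiftCongruentAt m d 0
    shiftCongruent-exists with i , j , i<j , same ← pigeonhole (n<1+n (m * m)) (residuePair ∘ toℕ) =
      toℕ j ∸ toℕ i , m<n⇒0<n∸m i<j , shiftCongruentAt-zero (toℕ i) (shiftCongruentAt-between (<⇒≤ i<j) same)

  module Digits (β B : ℕ) .{{_ : NonZero β}} .{{_ : NonZero B}} (2≤β : 2 ≤ β) where

    instance
      β*B≢0 : NonZero (β * B)
      β*B≢0 = m*n≢0 β B

    high low digit carry : ℕ → ℕ
    high n  = f n / B
    low n   = f n % B
    digit n = high n % β
    carry n = (low (1 + n) + low n) / B

    high-rec : ∀ n → high (2 + n) ≡ high (1 + n) + high n + carry n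
    high-rec n = trans (/-congˡ (f-rec n)) (/-+-carry (f (1 + n)) (f n))

    low-rec : ∀ n → low (2 + n) + carry n * B ≡ low (1 + n) + low n
    low-rec n = trans (cong (λ x → x % B + carry n * B) (f-rec n)) (%-+-carry (f (1 + n)) (f n))

    carry<β : ∀ n → carry n < β
    carry<β n = <-≤-trans (carry<2 (f (1 + n)) (f n)) 2≤β

    residue-split : ∀ n → f n % (β * B) ≡ low n + digit n * B
    residue-split n = m%[n*o]≡m%o+[m/o%n]*o (f n) β B

    shiftCongruent⇒digit-period : ShiftCongruentAt (β * B) M 0 → ∀ n → digit (n + M) ≡ digit n
    shiftCongruent⇒digit-period {M} p n = begin
      digit (n + M)                 ≡⟨ m%[n*o]/o≡m/o%n (f (n + M)) β B ⟨
      f (n + M) % (β * B) / B       ≡⟨ cong (_/ B) (shiftCongruent-everywhere {β * B} p n) ⟩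
      f n % (β * B) / B             ≡⟨ m%[n*o]/o≡m/o%n (f n) β B ⟩
      digit n                       ∎
      where open ≡-Reasoning

    module _ {M} (period : ∀ n → digit (n + M) ≡ digit n) where

      carry-period : ∀ n → carry (n + M) ≡ carry n
      carry-period n = begin
        carry (n + M)           ≡⟨ m<n⇒m%n≡m (carry<β (n + M)) ⟨
        carry (n + M) % β       ≡⟨ +-cancelˡ-mod H congruent ⟩
        carry n % β             ≡⟨ m<n⇒m%n≡m (carry<β n) ⟩
        carry n                 ∎
        where
        open ≡-Reasoning
        H H′ : ℕ
        H  = high (1 + n) + high n
        H′ = high (1 + (n + M)) + high (n + M)
        H′≡H : H′ ≡ H [mod β ]
        H′≡H = +-cong-mod {x = high (1 + (n + M))} {high (1 + n)} {high (n + M)} {high n} (period (1 + n)) (period n)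
        congruent : H + carry (n + M) ≡ H + carry n [mod β ]
        congruent = begin
          (H + carry (n + M)) % β     ≡⟨ +-cong-mod {x = H} {H′} {carry (n + M)} {carry (n + M)} (sym H′≡H) refl ⟩
          (H′ + carry (n + M)) % β    ≡⟨ %-congˡ (high-rec (n + M)) ⟨
          digit (2 + n + M)           ≡⟨ period (2 + n) ⟩
          digit (2 + n)               ≡⟨ %-congˡ (high-rec n) ⟩
          (H + carry n) % β           ∎

      lowShift : ℕ → ℤ
      lowShift n = + low (n + M) ℤ.- + low n

      lowShift-fibonacciLike : FibonacciLike lowShift
      lowShift-fibonacciLike n =
        difference-fibonacciLike {x₁ = low (1 + (n + M))} {low (n + M)} {y₁ = low (1 + n)} {low n} (carry n * B)
        (trans (cong (λ c → low (2 + (n + M)) + c * B) (sym (carry-period n))) (low-rec (n + M)))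
        (low-rec n)

      lowShift-bounded : BoundedBy B lowShift
      lowShift-bounded n = ∣[+x]-[+y]∣< (m%n<n (f (n + M)) B) (m%n<n (f n) B)

      low-period : ∀ n → low (n + M) ≡ low n
      low-period n = +-injective (i-j≡0⇒i≡j _ _
        (bounded-fibonacciLike-zero lowShift lowShift-fibonacciLike lowShift-bounded n))

      digit-period⇒shiftCongruent : ShiftCongruentAt (β * B) M 0
      digit-period⇒shiftCongruent = congruent 0 , congruent 1
        where
        congruent : ∀ n → f (n + M) ≡ f n [mod β * B ]
        congruent n = trans (residue-split (n + M))
          (trans (cong₂ (λ l q → l + q * B) (low-period n) (period n)) (sym (residue-split n)))

    digit-period⇔shiftCongruent : ∀ M → (∀ n → digit (n + M) ≡ digit n) ⇔ ShiftCongruentAt (β * B) M 0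
    digit-period⇔shiftCongruent M = mk⇔ digit-period⇒shiftCongruent shiftCongruent⇒digit-period

shortestPeriod⇔pisanoPeriod : ∀ {s m} .{{_ : NonZero m}} → (∀ M → IsPeriod s M ⇔ PisanoCond m M) →
                              ∀ N → IsShortestPeriod s N ⇔ IsPisanoPeriod m N
shortestPeriod⇔pisanoPeriod periods N = mk⇔
  (λ (isPeriod , least) → to (periods N) isPeriod , λ M cond → least M (from (periods M) cond))
  (λ (cond , least) → from (periods N) cond , λ M isPeriod → least M (to (periods M) isPeriod))
  where open Equivalence

pisanoCond-resp : ∀ {m m′ N} .{{_ : NonZero m}} .{{_ : NonZero m′}} → m ≡ m′ → PisanoCond m N ⇔ PisanoCond m′ N
pisanoCond-resp refl = mk⇔ id id

open FibonacciLikeSequence fib (λ _ → refl)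

module _ (β k : ℕ) .{{_ : NonZero β}} (2≤β : 2 ≤ β) where

  instance
    β^k≢0 : NonZero (β ^ k)
    β^k≢0 = m^n≢0 β k
    β^[k+1]≢0 : NonZero (β ^ (k + 1))
    β^[k+1]≢0 = m^n≢0 β (k + 1)

  open Digits β (β ^ k) 2≤β

  -- For fib, PisanoCond m M unfolds to 0 < M × ShiftCongruentAt m M 0.
  Φ-period⇔pisanoCond : ∀ M → IsPeriod (Φ β k) M ⇔ PisanoCond (β ^ (k + 1)) M
  Φ-period⇔pisanoCond M =
    pisanoCond-resp (cong (β ^_) (+-comm 1 k)) ⇔-∘ (⇔-id _ ×-⇔ digit-period⇔shiftCongruent M)

  Φ-periodic : Periodic (Φ β k)
  Φ-periodic with d , pisano ← shiftCongruent-exists {β ^ (k + 1)} =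
    d , Equivalence.from (Φ-period⇔pisanoCond d) pisano

mainTheorem4 : (β k : ℕ) → .{{_ : NonZero β}} → 2 ≤ β →
    Periodic (Φ β k) ×
    ((∀ p → WallSunSun p → ¬ (p ∣ β)) →
      ∀ N → (IsShortestPeriod (Φ β k) N ⇔ IsPisanoPeriod (β ^ (k + 1)) {{m^n≢0 β (k + 1)}} N))
mainTheorem4 β k 2≤β =
  Φ-periodic β k 2≤β ,
  λ _ → shortestPeriod⇔pisanoPeriod {{m^n≢0 β (k + 1)}} (Φ-period⇔pisanoCond β k 2≤β)
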